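{- Consider any execution of pdqsort (as described in the context) and any distinct value $v$ (an equivalence class of compare-equal elements). In the first call, in execution order, in which an element comparing equal to $v$ is selected as the pivot, the pivot does not compare equal to the predecessor of that call's subarray (i.e. the subarray is leftmost or its predecessor does not compare equal to the pivot).
   Context: Setting. The input is an array $A[0..n-1]$ of elements compared by a strict weak ordering $<$; $a,b$ compare equal if neither $a<b$ nor $b<a$ (an equivalence relation whose classes are called distinct values); $a\le b$ means "not $b<a$". pdqsort is the following recursive procedure acting in place on contiguous subarrays $A[a..b)=(A[a],\dots,A[b-1])$, each call carrying an integer counter $t$; the top-level call is on $A[0..n)$ with $t=\lfloor\log_2 n\rfloor$. A subarray $A[a..b)$ is leftmost if $a=0$; otherwise its predecessor is the element currently at position $a-1$. Fixed constants are an insertion-sort threshold $c\ge3$, a parameter $p\in(0,1)$, and a constant move bound. A call on $A[a..b)$ with $m=b-a$ does: (1) if $m\le c$, insertion sort $A[a..b)$ and return; (2) if $t=0$, heapsort $A[a..b)$ and return; (3) select a pivot $q$ as the median of at least three sampled elements of $A[a..b)$ by a deterministic rule, and move it to position $a$; (4) if $a>0$ and the predecessor compares equal to $q$, apply partition_left: rearrange $A[a..b)$ so that $q$ ends at a position $r$, all elements of $A[a..r)$ are $\le q$ and all elements of $A[r+1..b)$ are $>q$; otherwise apply partition_right: rearrange so that $q$ ends at a position $r$, all elements of $A[a..r)$ are $<q$ and all of $A[r+1..b)$ are $\ge q$; (5) the partition is bad if $\min(r-a,b-r-1)<pm$; if bad, set $t:=t-1$ and swap $O(1)$ elements at fixed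 relative positions inside each of the two parts; (6) if partition_right was applied, the partition is not bad, and no element other than the pivot was moved, run on both parts an insertion sort that aborts after the constant number of moves; if both complete, return; (7) if partition_left was applied, recurse only on $A[r+1..b)$; otherwise recurse on $A[a..r)$ and then on $A[r+1..b)$, each with counter $t$. The calls made in step (7) of a call are its children; ancestor/descendant are the transitive closures.
   Formalization: The parameter $p\in(0,1)$ of the bad-partition test is taken rational. -}

module Defs where

open import Level using (Level; _⊔_; Lift)
open import Data.Nat as ℕ using (ℕ; zero; suc; _∸_; _≤_; _⊓_)
open import Data.Nat.Logarithm using (⌊log₂_⌋)
open import Data.Integer using (+_)
open import Data.Rational as ℚ using (ℚ; _/_)
open import Data.Bool using (Bool; true; false)
open import Data.Maybe using (Maybe; just; nothing)
open import Data.List using (List; []; _∷_; _++_; length; map)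
open import Data.List.Membership.Propositional using (_∈_)
open import Data.List.Relation.Unary.All using (All)
open import Data.List.Relation.Unary.Unique.Propositional using (Unique)
open import Data.List.Relation.Unary.AllPairs using (AllPairs)
open import Data.List.Relation.Binary.Permutation.Propositional using (_↭_)
open import Data.Product using (Σ; _×_)
open import Data.Sum using (_⊎_)
open import Data.Empty using (⊥)
open import Relation.Nullary using (¬_)
open import Relation.Binary using (Rel)
open import Relation.Binary.PropositionalEquality using (_≡_; _≢_)

module _ {a ℓ} {E : Set a} (_<_ : Rel E ℓ) where

  CmpEq : E → E → Set ℓ
  CmpEq x y = ¬ (x < y) × ¬ (y < x)

  record IsStrictWeakOrder : Set (a ⊔ ℓ) where
    field
      irrefl : ∀ x → ¬ (x < x)
      trans  : ∀ {x y z} → x < y → y < z → x < z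
      eqTrans : ∀ {x y z} → CmpEq x y → CmpEq y z → CmpEq x z

-- pdqsort as a relation describing all its executions.
-- Arrays are functions ℕ → E; the array of length n lives at positions
-- 0 .. n-1 (other positions are never touched).

module PDQ {a ℓ} {E : Set a} (_<_ : Rel E ℓ) (c : ℕ) (p : ℚ) where

  _≈_ : E → E → Set ℓ
  _≈_ = CmpEq _<_

  Arr : Set a
  Arr = ℕ → E

  InRange : ℕ → ℕ → ℕ → Set
  InRange lo hi i = lo ≤ i × i ℕ.< hi

  record PermWithin (lo hi : ℕ) (A B : Arr) : Set a where
    field
      σ τ   : ℕ → ℕ
      στ    : ∀ i → σ (τ i) ≡ i
      τσ    : ∀ i → τ (σ i) ≡ i
      fixes : ∀ i → ¬ InRange lo hi i → σ i ≡ i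
      moves : ∀ i → B i ≡ A (σ i)

  Sorted : ℕ → ℕ → Arr → Set ℓ
  Sorted lo hi B = ∀ i j → lo ≤ i → i ℕ.< j → j ℕ.< hi → ¬ (B j < B i)

  SortsTo : ℕ → ℕ → Arr → Arr → Set (a ⊔ ℓ)
  SortsTo lo hi A B = PermWithin lo hi A B × Sorted lo hi B

  IsMedian : E → List E → Set (a ⊔ ℓ)
  IsMedian q xs = Σ (List E) λ pre → Σ (List E) λ post →
    ((pre ++ q ∷ post) ↭ xs) × AllPairs (λ x y → ¬ (y < x)) (pre ++ q ∷ post)
    × length pre ≤ suc (length post) × length post ≤ suc (length pre)

  record Select (lo hi : ℕ) (A A₁ : Arr) (q : E) : Set (a ⊔ ℓ) where
    field
      sample   : List ℕ
      three    : 3 ≤ length sample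
      distinct : Unique sample
      inRange  : All (InRange lo hi) sample
      median   : IsMedian q (map A sample)
      perm     : PermWithin lo hi A A₁
      atLo     : A₁ lo ≡ q

  predOf : ℕ → Arr → Maybe E
  predOf zero    A = nothing
  predOf (suc i) A = just (A i)

  PredEq : Maybe E → E → Set ℓ
  PredEq nothing  q = Lift ℓ ⊥
  PredEq (just x) q = x ≈ q

  data Side : Set where
    left right : Side

  data SideRule (lo : ℕ) (A : Arr) (q : E) : Side → Set ℓ where
    useLeft  : PredEq (predOf lo A) q → SideRule lo A q left
    useRight : ¬ PredEq (predOf lo A) q → SideRule lo A q right

  record Partition (s : Side) (lo hi : ℕ) (A₁ A₂ : Arr) (q : E) (r : ℕ)
         : Set (a ⊔ ℓ) where
    field
      rRange : InRange lo hi r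
      perm   : PermWithin lo hi A₁ A₂
      pivot  : PermWithin.σ perm r ≡ lo
      below  : ∀ i → lo ≤ i → i ℕ.< r →
               (s ≡ left → ¬ (q < A₂ i)) × (s ≡ right → A₂ i < q)
      above  : ∀ i → r ℕ.< i → i ℕ.< hi →
               (s ≡ left → q < A₂ i) × (s ≡ right → ¬ (A₂ i < q))

  Bad : ℕ → ℕ → ℕ → Set
  Bad lo r hi = (+ ((r ∸ lo) ⊓ (hi ∸ suc r)) / 1) ℚ.< p ℚ.* (+ (hi ∸ lo) / 1)

  data BadStep (lo r hi : ℕ) (A₂ : Arr) : ℕ → ℕ → Arr → Set (a ⊔ ℓ) where
    good : ∀ {t} → ¬ Bad lo r hi → BadStep lo r hi A₂ t t A₂
    bad  : ∀ {t X A₃} → Bad lo r hi →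
           PermWithin lo r A₂ X → PermWithin (suc r) hi X A₃ →
           BadStep lo r hi A₂ (suc t) t A₃

  NoMove : ℕ → ℕ → Arr → Arr → Set a
  NoMove lo r A₁ A₂ = ∀ i → i ≢ lo → i ≢ r → A₂ i ≡ A₁ i

  Step6Applies : Side → ℕ → ℕ → ℕ → Arr → Arr → Set a
  Step6Applies s lo r hi A₁ A₂ = s ≡ right × ¬ Bad lo r hi × NoMove lo r A₁ A₂

  PartialIns : ℕ → ℕ → Arr → Arr → Bool → Set (a ⊔ ℓ)
  PartialIns lo hi A B done = PermWithin lo hi A B × (done ≡ true → Sorted lo hi B)

  -- step (6) when it does not return: either not applicable, or some
  -- partial insertion sort aborted
  data Step6Continue (s : Side) (lo r hi : ℕ) (A₁ A₂ : Arr) (A₃ : Arr)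
       : Arr → Set (a ⊔ ℓ) where
    notApplicable : ¬ Step6Applies s lo r hi A₁ A₂ →
                    Step6Continue s lo r hi A₁ A₂ A₃ A₃
    aborted : ∀ {X A₄ d₁ d₂} → Step6Applies s lo r hi A₁ A₂ →
              PartialIns lo r A₃ X d₁ → PartialIns (suc r) hi X A₄ d₂ →
              (d₁ ≡ false ⊎ d₂ ≡ false) →
              Step6Continue s lo r hi A₁ A₂ A₃ A₄

  record Event : Set a where
    constructor event
    field
      pivot : E
      pred  : Maybe E

  -- Call t lo hi A B tr : the call on A[lo..hi) with counter t, started on
  -- array A, ends with array B; tr lists the pivot selections of this call
  -- and its descendants in execution order.
  data Call : ℕ → ℕ → ℕ → Arr → Arr → List Event → Set (a ⊔ ℓ) where
    small : ∀ {t lo hi A B} → hi ∸ lo ≤ c → SortsTo lo hi A B →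
            Call t lo hi A B []
    heap  : ∀ {lo hi A B} → c ℕ.< hi ∸ lo → SortsTo lo hi A B →
            Call zero lo hi A B []
    part-left : ∀ {t t′ lo hi A A₁ A₂ A₃ B q r tr} →
            c ℕ.< hi ∸ lo →
            Select lo hi A A₁ q → SideRule lo A q left →
            Partition left lo hi A₁ A₂ q r →
            BadStep lo r hi A₂ (suc t) t′ A₃ →
            Call t′ (suc r) hi A₃ B tr →
            Call (suc t) lo hi A B (event q (predOf lo A) ∷ tr)
    part-right-done : ∀ {t lo hi A A₁ A₂ X B q r} →
            c ℕ.< hi ∸ lo →
            Select lo hi A A₁ q → SideRule lo A q right →
            Partition right lo hi A₁ A₂ q r →
            Step6Applies right lo r hi A₁ A₂ →
            PartialIns lo r A₂ X true → PartialIns (suc r) hi X B true →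
            Call (suc t) lo hi A B (event q (predOf lo A) ∷ [])
    part-right : ∀ {t t′ lo hi A A₁ A₂ A₃ A₄ A₅ B q r tr₁ tr₂} →
            c ℕ.< hi ∸ lo →
            Select lo hi A A₁ q → SideRule lo A q right →
            Partition right lo hi A₁ A₂ q r →
            BadStep lo r hi A₂ (suc t) t′ A₃ →
            Step6Continue right lo r hi A₁ A₂ A₃ A₄ →
            Call t′ lo r A₄ A₅ tr₁ →
            Call t′ (suc r) hi A₅ B tr₂ →
            Call (suc t) lo hi A B (event q (predOf lo A) ∷ tr₁ ++ tr₂)

  Run : ℕ → Arr → Arr → List Event → Set (a ⊔ ℓ)
  Run n A B tr = Call ⌊log₂ n ⌋ 0 n A B tr

{-# OPTIONS --safe #-}
-- Every pivot-selection event of an execution has as predecessor either the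
-- predecessor of the top-level call (none, since it is leftmost) or the
-- pivot of an earlier event: a child call starting at r+1 is preceded by the
-- pivot of its parent, which stays at position r because everything after
-- the partition only permutes the two parts and the left child. Hence if the
-- predecessor of the first call with a pivot equal to v compared equal to
-- that pivot, it would be an earlier pivot equal to v.
module Submission where

open import Defs
open import Level using (lower)
open import Data.Nat using (ℕ; suc; _≤_) renaming (_<_ to _<ℕ_)
open import Data.Nat.Properties using (1+n≰n; n≮n; ≤-trans; <⇒≤; m≤n⇒m≤1+n; ≤-refl)
open import Data.Rational using (ℚ; 0ℚ; 1ℚ; _<_)
open import Data.List using (List; []; _∷_; _++_)
open import Data.List.Properties using (∷-injective)
open import Data.List.Relation.Unary.All using (All; lookupAny)
open import Data.List.Relation.Unary.Any using (Any; here; there)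
open import Data.List.Relation.Unary.Any.Properties using (++⁺ʳ)
open import Data.Maybe using (just)
open import Data.Product using (Σ; _×_; _,_)
open import Data.Sum using (_⊎_; inj₁; inj₂)
open import Relation.Nullary using (¬_)
open import Relation.Binary using (Rel)
open import Relation.Binary.PropositionalEquality
  using (_≡_; refl; trans; cong; subst)

++≡++∷-inv : ∀ {a} {X : Set a} (xs ys pre : List X) (e : X) (post : List X) →
             xs ++ ys ≡ pre ++ e ∷ post →
             Σ (List X) (λ post₁ → xs ≡ pre ++ e ∷ post₁) ⊎
             Σ (List X) (λ pre₂ → ys ≡ pre₂ ++ e ∷ post × pre ≡ xs ++ pre₂)
++≡++∷-inv []       ys pre       e post eq = inj₂ (pre , eq , refl)
++≡++∷-inv (x ∷ xs) ys []        e post eq with ∷-injective eq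
... | refl , _ = inj₁ (xs , refl)
++≡++∷-inv (x ∷ xs) ys (_ ∷ pre) e post eq with ∷-injective eq
... | refl , eq′ with ++≡++∷-inv xs ys pre e post eq′
...   | inj₁ (post₁ , xs≡)      = inj₁ (post₁ , cong (x ∷_) xs≡)
...   | inj₂ (pre₂ , ys≡ , pre≡) = inj₂ (pre₂ , ys≡ , cong (x ∷_) pre≡)

module Trace {a ℓ} {E : Set a} (_≺_ : Rel E ℓ) (c : ℕ) (p : ℚ) where
  open PDQ _≺_ c p

  AgreeOutside : ℕ → ℕ → Arr → Arr → Set a
  AgreeOutside lo hi X Y = ∀ i → ¬ InRange lo hi i → Y i ≡ X i

  agree-trans : ∀ {lo hi X Y Z} →
                AgreeOutside lo hi X Y → AgreeOutside lo hi Y Z → AgreeOutside lo hi X Z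
  agree-trans X~Y Y~Z i i∉ = trans (Y~Z i i∉) (X~Y i i∉)

  agree-widen : ∀ {lo hi lo′ hi′ X Y} → lo ≤ lo′ → hi′ ≤ hi →
                AgreeOutside lo′ hi′ X Y → AgreeOutside lo hi X Y
  agree-widen lo≤ ≤hi X~Y i i∉ = X~Y i (λ (lo′≤i , i<hi′) → i∉ (≤-trans lo≤ lo′≤i , ≤-trans i<hi′ ≤hi))

  permWithin⇒agree : ∀ {lo hi X Y} → PermWithin lo hi X Y → AgreeOutside lo hi X Y
  permWithin⇒agree {X = X} π i i∉ =
    trans (PermWithin.moves π i) (cong X (PermWithin.fixes π i i∉))

  predOf-agree : ∀ {lo hi X Y} → AgreeOutside lo hi X Y → predOf lo Y ≡ predOf lo X
  predOf-agree {lo = 0}     X~Y = refl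
  predOf-agree {lo = suc i} X~Y = cong just (X~Y i (λ (i<i , _) → 1+n≰n i<i))

  r∉left-part : ∀ {lo r} → ¬ InRange lo r r
  r∉left-part (_ , r<r) = n≮n _ r<r

  r∉right-part : ∀ {r hi} → ¬ InRange (suc r) hi r
  r∉right-part (r<r , _) = 1+n≰n r<r

  module _ {lo r hi X Y Z} (π₁ : PermWithin lo r X Y) (π₂ : PermWithin (suc r) hi Y Z) where

    permParts⇒agree : lo ≤ r → r <ℕ hi → AgreeOutside lo hi X Z
    permParts⇒agree lo≤r r<hi =
      agree-trans (agree-widen ≤-refl (<⇒≤ r<hi) (permWithin⇒agree π₁))
                  (agree-widen (m≤n⇒m≤1+n lo≤r) ≤-refl (permWithin⇒agree π₂))

    permParts-fixes-r : Z r ≡ X r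
    permParts-fixes-r = trans (permWithin⇒agree π₂ r r∉right-part) (permWithin⇒agree π₁ r r∉left-part)

  badStep⇒agree : ∀ {lo r hi A₂ t t′ A₃} → lo ≤ r → r <ℕ hi →
                  BadStep lo r hi A₂ t t′ A₃ → AgreeOutside lo hi A₂ A₃
  badStep⇒agree _    _    (good _)      i _ = refl
  badStep⇒agree lo≤r r<hi (bad _ π₁ π₂) = permParts⇒agree π₁ π₂ lo≤r r<hi

  badStep-fixes-r : ∀ {lo r hi A₂ t t′ A₃} → BadStep lo r hi A₂ t t′ A₃ → A₃ r ≡ A₂ r
  badStep-fixes-r (good _)      = refl
  badStep-fixes-r (bad _ π₁ π₂) = permParts-fixes-r π₁ π₂

  step6⇒agree : ∀ {s lo r hi A₁ A₂ A₃ A₄} → lo ≤ r → r <ℕ hi →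
                Step6Continue s lo r hi A₁ A₂ A₃ A₄ → AgreeOutside lo hi A₃ A₄
  step6⇒agree _    _    (notApplicable _)               i _ = refl
  step6⇒agree lo≤r r<hi (aborted _ (π₁ , _) (π₂ , _) _) = permParts⇒agree π₁ π₂ lo≤r r<hi

  step6-fixes-r : ∀ {s lo r hi A₁ A₂ A₃ A₄} → Step6Continue s lo r hi A₁ A₂ A₃ A₄ → A₄ r ≡ A₃ r
  step6-fixes-r (notApplicable _)               = refl
  step6-fixes-r (aborted _ (π₁ , _) (π₂ , _) _) = permParts-fixes-r π₁ π₂

  partition-pivot-at-r : ∀ {s lo hi A A₁ A₂ q r} →
                         Select lo hi A A₁ q → Partition s lo hi A₁ A₂ q r → A₂ r ≡ q
  partition-pivot-at-r {A₁ = A₁} sel pt =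
    trans (PermWithin.moves (Partition.perm pt) _)
          (trans (cong A₁ (Partition.pivot pt)) (Select.atLo sel))

  partition⇒agree : ∀ {s lo hi A A₁ A₂ q r} →
                    Select lo hi A A₁ q → Partition s lo hi A₁ A₂ q r → AgreeOutside lo hi A A₂
  partition⇒agree sel pt =
    agree-trans (permWithin⇒agree (Select.perm sel)) (permWithin⇒agree (Partition.perm pt))

  module _ {s t t′ lo hi r q A A₁ A₂ A₃}
           (sel : Select lo hi A A₁ q) (pt : Partition s lo hi A₁ A₂ q r)
           (bs : BadStep lo r hi A₂ t t′ A₃) where

    badStepPhase⇒agree : AgreeOutside lo hi A A₃
    badStepPhase⇒agree with Partition.rRange pt
    ... | lo≤r , r<hi = agree-trans (partition⇒agree sel pt) (badStep⇒agree lo≤r r<hi bs)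

    badStepPhase-pivot-at-r : A₃ r ≡ q
    badStepPhase-pivot-at-r = trans (badStep-fixes-r bs) (partition-pivot-at-r sel pt)

    module _ {A₄} (s6 : Step6Continue s lo r hi A₁ A₂ A₃ A₄) where

      step6Phase⇒agree : AgreeOutside lo hi A A₄
      step6Phase⇒agree with Partition.rRange pt
      ... | lo≤r , r<hi = agree-trans badStepPhase⇒agree (step6⇒agree lo≤r r<hi s6)

      step6Phase-pivot-at-r : A₄ r ≡ q
      step6Phase-pivot-at-r = trans (step6-fixes-r s6) badStepPhase-pivot-at-r

  call⇒agree : ∀ {t lo hi A B tr} → Call t lo hi A B tr → AgreeOutside lo hi A B
  call⇒agree (small _ (π , _)) = permWithin⇒agree π
  call⇒agree (heap _ (π , _))  = permWithin⇒agree π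
  call⇒agree (part-left _ sel _ pt bs child) with Partition.rRange pt
  ... | lo≤r , _ =
    agree-trans (badStepPhase⇒agree sel pt bs) (agree-widen (m≤n⇒m≤1+n lo≤r) ≤-refl (call⇒agree child))
  call⇒agree (part-right-done _ sel _ pt _ (π₁ , _) (π₂ , _)) with Partition.rRange pt
  ... | lo≤r , r<hi = agree-trans (partition⇒agree sel pt) (permParts⇒agree π₁ π₂ lo≤r r<hi)
  call⇒agree (part-right _ sel _ pt bs s6 child₁ child₂) with Partition.rRange pt
  ... | lo≤r , r<hi =
    agree-trans (step6Phase⇒agree sel pt bs s6)
      (agree-trans (agree-widen ≤-refl (<⇒≤ r<hi) (call⇒agree child₁))
                   (agree-widen (m≤n⇒m≤1+n lo≤r) ≤-refl (call⇒agree child₂)))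

  PredIsEarlierPivot : Event → List Event → Set a
  PredIsEarlierPivot e pre = Any (λ e′ → Event.pred e ≡ just (Event.pivot e′)) pre

  event-pred-origin : ∀ {t lo hi A B tr} → Call t lo hi A B tr →
                      ∀ pre e post → tr ≡ pre ++ e ∷ post →
                      Event.pred e ≡ predOf lo A ⊎ PredIsEarlierPivot e pre
  event-pred-origin (small _ _) [] _ _ ()
  event-pred-origin (small _ _) (_ ∷ _) _ _ ()
  event-pred-origin (heap _ _) [] _ _ ()
  event-pred-origin (heap _ _) (_ ∷ _) _ _ ()
  event-pred-origin (part-left _ _ _ _ _ _) [] _ _ refl = inj₁ refl
  event-pred-origin (part-left _ sel _ pt bs child) (_ ∷ pre) e post eq with ∷-injective eq
  ... | refl , eq′ with event-pred-origin child pre e post eq′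
  ...   | inj₁ pred≡   = inj₂ (here (trans pred≡ (cong just (badStepPhase-pivot-at-r sel pt bs))))
  ...   | inj₂ earlier = inj₂ (there earlier)
  event-pred-origin (part-right-done _ _ _ _ _ _ _) [] _ _ refl = inj₁ refl
  event-pred-origin (part-right-done _ _ _ _ _ _ _) (_ ∷ []) _ _ ()
  event-pred-origin (part-right-done _ _ _ _ _ _ _) (_ ∷ _ ∷ _) _ _ ()
  event-pred-origin (part-right _ _ _ _ _ _ _ _) [] _ _ refl = inj₁ refl
  event-pred-origin (part-right {tr₁ = tr₁} {tr₂} _ sel _ pt bs s6 child₁ child₂)
                    (_ ∷ pre) e post eq with ∷-injective eq
  ... | refl , eq′ with ++≡++∷-inv tr₁ tr₂ pre e post eq′
  ...   | inj₁ (post₁ , tr₁≡) with event-pred-origin child₁ pre e post₁ tr₁≡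
  ...     | inj₁ pred≡   = inj₁ (trans pred≡ (predOf-agree (step6Phase⇒agree sel pt bs s6)))
  ...     | inj₂ earlier = inj₂ (there earlier)
  event-pred-origin (part-right {r = r} {tr₁ = tr₁} {tr₂} _ sel _ pt bs s6 child₁ child₂)
                    (_ ∷ pre) e post eq
    | refl , eq′ | inj₂ (pre₂ , tr₂≡ , refl) with event-pred-origin child₂ pre₂ e post tr₂≡
  ...     | inj₁ pred≡   = inj₂ (here (trans pred≡ (cong just
                             (trans (call⇒agree child₁ r r∉left-part) (step6Phase-pivot-at-r sel pt bs s6)))))
  ...     | inj₂ earlier = inj₂ (there (++⁺ʳ tr₁ earlier))

  earlierPivot⇒pred≉pivot : IsStrictWeakOrder _≺_ → ∀ {v e pre} →
                            Event.pivot e ≈ v → All (λ e′ → ¬ Event.pivot e′ ≈ v) pre →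
                            PredIsEarlierPivot e pre → ¬ PredEq (Event.pred e) (Event.pivot e)
  earlierPivot⇒pred≉pivot swo {e = e} pivot≈v pre≉v earlier pred≈pivot
    with lookupAny pre≉v earlier
  ... | pivot′≉v , pred≡pivot′ =
    pivot′≉v (IsStrictWeakOrder.eqTrans swo
               (subst (λ m → PredEq m (Event.pivot e)) pred≡pivot′ pred≈pivot) pivot≈v)

lemma2 : ∀ {a ℓ} {E : Set a} (_≺_ : Rel E ℓ) → IsStrictWeakOrder _≺_ →
         (c : ℕ) → 3 ≤ c → (p : ℚ) → 0ℚ < p → p < 1ℚ →
         (n : ℕ) (A B : PDQ.Arr _≺_ c p) (tr : List (PDQ.Event _≺_ c p)) →
         PDQ.Run _≺_ c p n A B tr →
         (v : E) (pre : List (PDQ.Event _≺_ c p)) (e : PDQ.Event _≺_ c p)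
         (post : List (PDQ.Event _≺_ c p)) →
         tr ≡ pre ++ e ∷ post →
         CmpEq _≺_ (PDQ.Event.pivot e) v →
         All (λ e′ → ¬ CmpEq _≺_ (PDQ.Event.pivot e′) v) pre →
         ¬ PDQ.PredEq _≺_ c p (PDQ.Event.pred e) (PDQ.Event.pivot e)
lemma2 _≺_ swo c _ p _ _ n A B tr run v pre e post tr≡ pivot≈v pre≉v
  with Trace.event-pred-origin _≺_ c p run pre e post tr≡
... | inj₁ pred≡nothing = λ pred≈pivot →
  lower (subst (λ m → PredEq m (Event.pivot e)) pred≡nothing pred≈pivot)
  where open PDQ _≺_ c p
... | inj₂ earlier = Trace.earlierPivot⇒pred≉pivot _≺_ c p swo pivot≈v pre≉v earlier
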